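{- Let $F$ be an infinite family of admissible sets, linearly ordered by $\subseteq$, such that $I_2\setminus I_1$ is infinite whenever $I_1,I_2\in F$ and $I_1\subsetneq I_2$, and suppose $\langle F;\subseteq\rangle$ is dense (between any two distinct elements of $F$ there is a third). Then $|\overline{F}|\geq 2^\omega$.
   Context: Fix a relational language $\Sigma$ and a complete theory $T_0$ in $\Sigma$ which is language uniform (LU): for each arity $n$, every permutation of the set of $n$-ary symbols $R$ with $T_0\vdash\exists\bar x R(\bar x)$ (non-empty predicates), extended by the identity elsewhere, maps $T_0$ onto $T_0$. Fix $n$ such that the set of non-empty $n$-ary predicates of $T_0$ is infinite, written $\{R_k:k\in I_0\}$; let $\kappa$ be the number of empty $n$-ary predicates of $T_0$. Call $I\subseteq I_0$ admissible if $I$ is infinite, $|I|=|I_0|$ and $|I_0\setminus I|=\kappa$. For a family $F$ of subsets of $I_0$, $\overline{F}=F\cup\{\bigcup F':F'\subseteq F\text{ infinite}\}\cup\{\bigcap F':F'\subseteq F\text{ infinite}\}$. -}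

module Defs where

open import Level using (0ℓ)
open import Data.Nat using (ℕ)
open import Data.Bool using (Bool)
open import Data.Product using (Σ; Σ-syntax; _×_; _,_; proj₁)
open import Data.Sum using (_⊎_)
open import Relation.Nullary using (¬_)
open import Relation.Binary.PropositionalEquality using (_≡_; _≢_)
open import Relation.Unary using (Pred; _∈_; _∉_; _⊆_; _≐_; ⋃; ⋂)
open import Function.Bundles using (_⤖_)

Subset : Set → Set₁
Subset X = Pred X 0ℓ

Infinite : Set → Set
Infinite Y = Σ[ f ∈ (ℕ → Y) ] (∀ i j → f i ≡ f j → i ≡ j)

Elems : {X : Set} → Subset X → Set
Elems {X} S = Σ[ x ∈ X ] x ∈ S

Compl : {X : Set} → Subset X → Set
Compl {X} S = Σ[ x ∈ X ] x ∉ S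

Diff : {X : Set} → Subset X → Subset X → Set
Diff {X} T S = Σ[ x ∈ X ] (x ∈ T × x ∉ S)

_⊊_ : {X : Set} → Subset X → Subset X → Set
S ⊊ T = (S ⊆ T) × ¬ (T ⊆ S)

-- Admissibility of I ⊆ I₀, where K is a set of cardinality κ:
-- I infinite, |I| = |I₀|, |I₀ \ I| = κ.
Admissible : (I₀ K : Set) → Subset I₀ → Set
Admissible I₀ K I = Infinite (Elems I) × (Elems I ⤖ I₀) × (Compl I ⤖ K)

-- A family of subsets of X is presented as an indexed family A : J → Subset X;
-- the family is the set of its values {A j : j ∈ J}.
-- A subfamily F' ⊆ F is given by a predicate P on indices; it is infinite if it
-- contains infinitely many pairwise distinct (as sets) members.
InfiniteSubfamily : {X J : Set} → (J → Subset X) → (J → Set) → Set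
InfiniteSubfamily {J = J} A P =
  Σ[ g ∈ (ℕ → J) ] ((∀ i → P (g i)) × (∀ i j → i ≢ j → ¬ (A (g i) ≐ A (g j))))

InfiniteFamily : {X J : Set} → (J → Subset X) → Set
InfiniteFamily {J = J} A =
  Σ[ g ∈ (ℕ → J) ] (∀ i j → i ≢ j → ¬ (A (g i) ≐ A (g j)))

UnionSub : {X J : Set} → (J → Subset X) → (J → Set) → Subset X
UnionSub {J = J} A P = ⋃ (Σ J P) (λ p → A (proj₁ p))

InterSub : {X J : Set} → (J → Subset X) → (J → Set) → Subset X
InterSub {J = J} A P = ⋂ (Σ J P) (λ p → A (proj₁ p))

-- Membership of a subset B in the closure F̄ = F ∪ {⋃F'} ∪ {⋂F'}
-- (F' ranging over infinite subfamilies), up to extensional equality.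
InClosure : {X J : Set} → (J → Subset X) → Subset X → Set₁
InClosure {J = J} A B =
  (Σ[ j ∈ J ] B ≐ A j)
  ⊎ ((Σ[ P ∈ (J → Set) ] (InfiniteSubfamily A P × B ≐ UnionSub A P))
  ⊎ (Σ[ P ∈ (J → Set) ] (InfiniteSubfamily A P × B ≐ InterSub A P)))

-- |F̄| ≥ 2^ω : an injection of Cantor space ℕ → Bool into F̄
-- (injective w.r.t. pointwise equality of sequences and ≐ of subsets).
CardClosure≥Continuum : {X J : Set} → (J → Subset X) → Set₁
CardClosure≥Continuum {X} A =
  Σ[ f ∈ ((ℕ → Bool) → Subset X) ]
    ((∀ α → InClosure A (f α))
    × (∀ α β → f α ≐ f β → ∀ n → α n ≡ β n))

-- Only density and the existence of one strict inclusion are used; the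
-- admissibility, linearity and infinite-difference hypotheses of the
-- theorem serve only to obtain that strict inclusion.  The argument is a
-- Cantor-style binary tree of nested "intervals" (pairs j, k with
-- A j ⊊ A k).  Every interval I has two children, each with a strictly
-- larger lower end and a smaller upper end, and with a gap between them:
-- the upper end of the left child lies strictly below the lower end of the
-- right child.  A path α : ℕ → Bool through the tree yields a strictly
-- increasing sequence of lower ends; its union U α is the union of an
-- infinite subfamily, hence lies in the closure.  Two paths that first
-- differ at level n give unions separated by the gap at the common node of
-- level n, so α ↦ U α is injective.
module Submission where

open import Defs
open import Data.Product using (Σ-syntax; _×_; _,_; proj₁; proj₂)
open import Data.Sum using (_⊎_; inj₁; inj₂)
open import Relation.Unary using (_⊆_; _≐_)
open import Relation.Unary.Properties using (⊂-trans)
open import Data.Nat using (ℕ; zero; suc; _<_; _≤_; _≤′_; ≤′-refl; ≤′-step; _⊔_)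
open import Data.Nat.Properties using (≤⇒≤′; <-cmp; m≤m⊔n; m≤n⊔m; m<1+n⇒m<n∨m≡n; m<n⇒m<1+n; n<1+n)
open import Data.Bool using (Bool; true; false)
open import Data.Empty using (⊥-elim)
open import Relation.Nullary using (¬_)
open import Relation.Binary.PropositionalEquality using (_≡_; _≢_; refl; sym; cong; cong₂; subst)
open import Relation.Binary.Definitions using (tri<; tri≈; tri>)

module Sequences {X : Set} where

  ascending : (S : ℕ → Subset X) → (∀ n → S n ⊆ S (suc n))
            → ∀ {m n} → m ≤ n → S m ⊆ S n
  ascending S step m≤n = go (≤⇒≤′ m≤n)
    where
    go : ∀ {m n} → m ≤′ n → S m ⊆ S n
    go ≤′-refl      x = x
    go (≤′-step p) x = step _ (go p x)

  descending : (T : ℕ → Subset X) → (∀ n → T (suc n) ⊆ T n)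
             → ∀ {m n} → m ≤ n → T n ⊆ T m
  descending T step m≤n = go (≤⇒≤′ m≤n)
    where
    go : ∀ {m n} → m ≤′ n → T n ⊆ T m
    go ≤′-refl      x = x
    go (≤′-step p) x = go p (step _ x)

  strictly-ascending : (S : ℕ → Subset X) → (∀ n → S n ⊊ S (suc n))
                     → ∀ {m n} → m < n → ¬ (S n ⊆ S m)
  strictly-ascending S step {m} m<n Sn⊆Sm =
    proj₂ (step m) (λ x → Sn⊆Sm (ascending S (λ k → proj₁ (step k)) m<n x))

  strictly-ascending-distinct : (S : ℕ → Subset X) → (∀ n → S n ⊊ S (suc n))
                              → ∀ i j → i ≢ j → ¬ (S i ≐ S j)
  strictly-ascending-distinct S step i j i≢j (Si⊆Sj , Sj⊆Si) with <-cmp i j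
  ... | tri< i<j _ _ = strictly-ascending S step i<j Sj⊆Si
  ... | tri≈ _ i≡j _ = i≢j i≡j
  ... | tri> _ _ j<i = strictly-ascending S step j<i Si⊆Sj

  below-all : (S T : ℕ → Subset X)
            → (∀ n → S n ⊆ S (suc n)) → (∀ n → T (suc n) ⊆ T n)
            → (∀ n → S n ⊆ T n) → ∀ m k → S m ⊆ T k
  below-all S T S-up T-down S⊆T m k x =
    descending T T-down (m≤n⊔m m k) (S⊆T (m ⊔ k) (ascending S S-up (m≤m⊔n m k) x))

module DenseTree {X J : Set} (A : J → Subset X)
  (dense : ∀ j k → A j ⊊ A k → Σ[ l ∈ J ] (A j ⊊ A l × A l ⊊ A k)) where

  open Sequences {X}

  record Interval : Set where
    constructor interval
    field
      lo hi : J
      lo⊊hi : A lo ⊊ A hi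
  open Interval

  mid : Interval → J
  mid I = proj₁ (dense (lo I) (hi I) (lo⊊hi I))

  lo⊊mid : (I : Interval) → A (lo I) ⊊ A (mid I)
  lo⊊mid I = proj₁ (proj₂ (dense (lo I) (hi I) (lo⊊hi I)))

  mid⊊hi : (I : Interval) → A (mid I) ⊊ A (hi I)
  mid⊊hi I = proj₂ (proj₂ (dense (lo I) (hi I) (lo⊊hi I)))

  lower-half upper-half : Interval → Interval
  lower-half I = interval (lo I) (mid I) (lo⊊mid I)
  upper-half I = interval (mid I) (hi I) (mid⊊hi I)

  -- The right child of I = [a, b] is [m, b] for a midpoint m; the left
  -- child is [q, p] with a ⊊ q ⊊ p ⊊ m, so both have a larger lower end.
  child : Bool → Interval → Interval
  child false I = upper-half (lower-half (lower-half I))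
  child true  I = upper-half I

  child-lo : ∀ b I → A (lo I) ⊊ A (lo (child b I))
  child-lo false I = lo⊊mid (lower-half (lower-half I))
  child-lo true  I = lo⊊mid I

  child-hi : ∀ b I → A (hi (child b I)) ⊆ A (hi I)
  child-hi false I = proj₁ (⊂-trans (mid⊊hi (lower-half I)) (mid⊊hi I))
  child-hi true  I x = x

  children-gap : (I : Interval) → ¬ (A (lo (child true I)) ⊆ A (hi (child false I)))
  children-gap I = proj₂ (mid⊊hi (lower-half I))

  path : Interval → (ℕ → Bool) → ℕ → Interval
  path S α zero    = S
  path S α (suc n) = child (α n) (path S α n)

  path-agree : ∀ S α β n → (∀ k → k < n → α k ≡ β k) → path S α n ≡ path S β n
  path-agree S α β zero    _     = refl
  path-agree S α β (suc n) agree =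
    cong₂ child (agree n (n<1+n n))
      (path-agree S α β n (λ k k<n → agree k (m<n⇒m<1+n k<n)))

  module Path (S : Interval) (α : ℕ → Bool) where

    lowers uppers : ℕ → Subset X
    lowers n = A (lo (path S α n))
    uppers n = A (hi (path S α n))

    lowers-strict : ∀ n → lowers n ⊊ lowers (suc n)
    lowers-strict n = child-lo (α n) (path S α n)

    lowers⊆uppers : ∀ m k → lowers m ⊆ uppers k
    lowers⊆uppers = below-all lowers uppers
      (λ n → proj₁ (lowers-strict n)) (λ n → child-hi (α n) (path S α n))
      (λ n → proj₁ (lo⊊hi (path S α n)))

    OnPath : J → Set
    OnPath j = Σ[ n ∈ ℕ ] lo (path S α n) ≡ j

    on-path-infinite : InfiniteSubfamily A OnPath
    on-path-infinite = (λ n → lo (path S α n)) , (λ n → n , refl)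
                     , strictly-ascending-distinct lowers lowers-strict

    limit : Subset X
    limit = UnionSub A OnPath

    lowers⊆limit : ∀ n → lowers n ⊆ limit
    lowers⊆limit n x = (lo (path S α n) , n , refl) , x

    limit⊆uppers : ∀ k → limit ⊆ uppers k
    limit⊆uppers k {x} ((_ , n , refl) , x∈) = lowers⊆uppers n k x∈

  open Path

  -- If α turns left and β right at a common node of level n, then the limit
  -- of β is not contained in the limit of α: the gap lies between them.
  separate : ∀ S α β n → path S α n ≡ path S β n → α n ≡ false → β n ≡ true
           → ¬ (limit S β ⊆ limit S α)
  separate S α β n same αn βn β⊆α =
    children-gap I (λ {x} x∈ →
      subst (λ K → A (hi K) x) left-node
        (limit⊆uppers S α (suc n)
          (β⊆α (lowers⊆limit S β (suc n) (subst (λ K → A (lo K) x) (sym right-node) x∈)))))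
    where
    I = path S α n
    left-node : path S α (suc n) ≡ child false I
    left-node = cong (λ b → child b I) αn
    right-node : path S β (suc n) ≡ child true I
    right-node = cong₂ child βn (sym same)

  equal-limits-next : ∀ S α β → limit S α ≐ limit S β
                    → ∀ n → (∀ k → k < n → α k ≡ β k) → α n ≡ β n
  equal-limits-next S α β (α⊆β , β⊆α) n agree with α n in αn | β n in βn
  ... | false | false = refl
  ... | true  | true  = refl
  ... | false | true  = ⊥-elim (separate S α β n (path-agree S α β n agree) αn βn β⊆α)
  ... | true  | false =
    ⊥-elim (separate S β α n (sym (path-agree S α β n agree)) βn αn α⊆β)

  equal-limits-agree : ∀ S α β → limit S α ≐ limit S β → ∀ n k → k < n → α k ≡ β k
  equal-limits-agree S α β eq (suc n) k k<1+n with m<1+n⇒m<n∨m≡n k<1+n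
  ... | inj₁ k<n  = equal-limits-agree S α β eq n k k<n
  ... | inj₂ refl = equal-limits-next S α β eq k (equal-limits-agree S α β eq k)

  continuum-many-limits : Interval → CardClosure≥Continuum A
  continuum-many-limits S =
    limit S
    , (λ α → inj₂ (inj₁ (OnPath S α , on-path-infinite S α , (λ x → x) , (λ x → x))))
    , (λ α β eq n → equal-limits-agree S α β eq (suc n) n (n<1+n n))

strict-pair : {X J : Set} (A : J → Subset X) → InfiniteFamily A
            → (∀ j k → (A j ⊆ A k) ⊎ (A k ⊆ A j))
            → Σ[ j ∈ J ] Σ[ k ∈ J ] A j ⊊ A k
strict-pair A (g , distinct) linear with linear (g 0) (g 1)
... | inj₁ g0⊆g1 = g 0 , g 1 , g0⊆g1 , (λ g1⊆g0 → distinct 0 1 (λ ()) (g0⊆g1 , g1⊆g0))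
... | inj₂ g1⊆g0 = g 1 , g 0 , g1⊆g0 , (λ g0⊆g1 → distinct 0 1 (λ ()) (g0⊆g1 , g1⊆g0))

proposition4p9 : (I₀ K : Set) → Infinite I₀
    → (J : Set) → (A : J → Subset I₀)
    → (∀ j → Admissible I₀ K (A j))
    → InfiniteFamily A
    → (∀ j k → (A j ⊆ A k) ⊎ (A k ⊆ A j))
    → (∀ j k → A j ⊊ A k → Infinite (Diff (A k) (A j)))
    → (∀ j k → A j ⊊ A k → Σ[ l ∈ J ] (A j ⊊ A l × A l ⊊ A k))
    → CardClosure≥Continuum A
proposition4p9 I₀ K _ J A _ infinite linear _ dense
  with strict-pair A infinite linear
... | j , k , j⊊k = DenseTree.continuum-many-limits A dense (DenseTree.interval j k j⊊k)
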